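{- Let $G$ be a graph with maximum degree $\Delta(G)$, and let $\mathcal{G}$ be the disjoint union of $\Delta(G)+1$ copies of $G$. Then for every positive integer $k$, $Tr(G)=k$ if and only if $TTr(\mathcal{G})=k$.
   Context: All graphs are finite and simple. For disjoint vertex sets $A,B$, $A$ dominates $B$ if every vertex of $B$ has a neighbour in $A$. A transitive partition of order $k$ of $G=(V,E)$ is a partition $\{V_1,\dots,V_k\}$ of $V$ into nonempty sets with $V_i$ dominating $V_j$ for all $1\le i<j\le k$; the transitivity $Tr(G)$ is the maximum such $k$. A tournament transitive partition additionally requires that $V_j$ does not dominate $V_i$ for all $i<j$; the tournament transitivity $TTr(G)$ is the maximum order of such a partition. -}

module Defs where

open import Data.Nat using (ℕ; zero; suc; _*_; _<_; _≤_; _⊔_)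
open import Data.Fin using (Fin; toℕ; remQuot; _≟_)
open import Data.Bool using (Bool; true; false; _∧_)
open import Data.List using (List; length; filter; map; foldr; allFin)
open import Data.Product using (Σ; ∃; _×_; _,_; proj₁; proj₂)
open import Relation.Nullary using (¬_; yes; no)
open import Relation.Nullary.Decidable using (⌊_⌋)
open import Relation.Binary.PropositionalEquality using (_≡_; refl; sym; trans; cong; cong₂)
open import Data.Bool.Properties using (T?)

record Graph (n : ℕ) : Set where
  field
    adj   : Fin n → Fin n → Bool
    adj-sym : ∀ u v → adj u v ≡ adj v u
    irrfl : ∀ v → adj v v ≡ false
open Graph public

degree : ∀ {n} → Graph n → Fin n → ℕ
degree G v = length (filter (λ u → T? (adj G v u)) (allFin _))

maxDegree : ∀ {n} → Graph n → ℕ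
maxDegree G = foldr _⊔_ 0 (map (degree G) (allFin _))

-- disjoint union of c copies of G; vertex x of Fin (c * n) is the pair
-- (copy index, vertex of G) given by remQuot
sameCopy : ∀ {c} → Fin c → Fin c → Bool
sameCopy i j = ⌊ i ≟ j ⌋

private
  sameCopy-sym : ∀ {c} (i j : Fin c) → sameCopy i j ≡ sameCopy j i
  sameCopy-sym i j with i ≟ j | j ≟ i
  ... | yes _ | yes _ = refl
  ... | no _  | no _  = refl
  ... | yes p | no q  with q (sym p)
  ... | ()
  sameCopy-sym i j | no q | yes p with q (sym p)
  ... | ()

  ∧-false : ∀ b → (b ∧ false) ≡ false
  ∧-false true = refl
  ∧-false false = refl

copyOf : (c : ℕ) → ∀ {n} → Fin (c * n) → Fin c
copyOf c {n} x = proj₁ (remQuot {c} n x)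

vertexOf : (c : ℕ) → ∀ {n} → Fin (c * n) → Fin n
vertexOf c {n} x = proj₂ (remQuot {c} n x)

copies : (c : ℕ) → ∀ {n} → Graph n → Graph (c * n)
copies c {n} G = record { adj = A ; adj-sym = S ; irrfl = I }
  where
  A : Fin (c * n) → Fin (c * n) → Bool
  A x y = sameCopy (copyOf c x) (copyOf c y) ∧ adj G (vertexOf c x) (vertexOf c y)
  S : ∀ x y → A x y ≡ A y x
  S x y = cong₂ _∧_ (sameCopy-sym (copyOf c x) (copyOf c y))
                    (Graph.adj-sym G (vertexOf c x) (vertexOf c y))
  I : ∀ x → A x x ≡ false
  I x = trans (cong (sameCopy (copyOf c x) (copyOf c x) ∧_) (Graph.irrfl G (vertexOf c x)))
              (∧-false _)

-- A partition of V into k nonempty classes V_1..V_k, given by the class map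
-- f : Fin n → Fin k (class i is f⁻¹(i)); nonempty = f surjective.
Nonempty-classes : ∀ {n k} → (Fin n → Fin k) → Set
Nonempty-classes {n} f = ∀ i → ∃ λ (v : Fin n) → f v ≡ i

Dominates : ∀ {n k} → Graph n → (Fin n → Fin k) → Fin k → Fin k → Set
Dominates {n} G f i j = ∀ (v : Fin n) → f v ≡ j →
  ∃ λ (u : Fin n) → f u ≡ i × adj G u v ≡ true

IsTransitivePartition : ∀ {n k} → Graph n → (Fin n → Fin k) → Set
IsTransitivePartition {k = k} G f =
  Nonempty-classes f × (∀ (i j : Fin k) → toℕ i < toℕ j → Dominates G f i j)

IsTournamentTransitivePartition : ∀ {n k} → Graph n → (Fin n → Fin k) → Set
IsTournamentTransitivePartition {k = k} G f =
  Nonempty-classes f ×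
  (∀ (i j : Fin k) → toℕ i < toℕ j → Dominates G f i j × ¬ Dominates G f j i)

HasTP : ∀ {n} → Graph n → ℕ → Set
HasTP {n} G k = Σ (Fin n → Fin k) (IsTransitivePartition G)

HasTTP : ∀ {n} → Graph n → ℕ → Set
HasTTP {n} G k = Σ (Fin n → Fin k) (IsTournamentTransitivePartition G)

Tr≡ : ∀ {n} → Graph n → ℕ → Set
Tr≡ G k = HasTP G k × (∀ m → HasTP G m → m ≤ k)

TTr≡ : ∀ {n} → Graph n → ℕ → Set
TTr≡ G k = HasTTP G k × (∀ m → HasTTP G m → m ≤ k)

{-# OPTIONS --safe #-}
module Submission where

-- A vertex in the last class of a transitive partition of order m + 1 has neighbours in the
-- m earlier classes, all distinct, so m ≤ Δ(G) and there are enough copies to give each class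
-- of a transitive partition f of G its own copy.  Put vertex v of copy t into class min (f v, t):
-- this is still transitive, and class i of f reappears in copy i, whose vertices all lie in
-- classes ≤ i, so no later class dominates class i.  Conversely, a transitive partition of the
-- union restricts to the copy meeting its last class, since every class dominates that vertex
-- and adjacency never leaves a copy.

open import Defs
open import Data.Bool using (true; _∧_; T)
open import Data.Bool.Properties using (T?)
open import Data.Fin using (Fin; toℕ; fromℕ; fromℕ<; inject₁; inject≤; combine; _≟_)
open import Data.Fin.Properties
  using (toℕ<n; toℕ-fromℕ; toℕ-fromℕ<; toℕ-inject₁; toℕ-inject≤; toℕ-injective; inject₁-injective;
         ≤fromℕ; ≤∧≢⇒<; injective⇒≤; remQuot-combine; combine-surjective)
open import Data.List using (List; _∷_; length; foldr; lookup)
open import Data.List.Membership.Propositional using (_∈_)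
open import Data.List.Membership.Propositional.Properties using (∈-filter⁺; ∈-allFin; ∈-map⁺)
open import Data.List.Relation.Unary.Any using (here; there; index)
open import Data.List.Relation.Unary.Any.Properties using (lookup-index)
open import Data.Nat using (ℕ; zero; suc; _*_; _≤_; _<_; _⊔_; _⊓_; z≤n; s≤s)
open import Data.Nat.Properties
  using (≤-trans; ≤-reflexive; <-≤-trans; <⇒≤; <⇒≱; m≤m⊔n; m≤n⊔m; m≤n⊓o⇒m≤n; m≤n⊓o⇒m≤o;
         m<n⇒m⊓o<n; m≤n⇒m⊓n≡m)
open import Data.Product using (∃; _×_; _,_; proj₁; proj₂; map₂)
open import Function using (_∘_)
open import Function.Bundles using (_⇔_; mk⇔)
open import Function.Definitions using (Injective)
open import Relation.Nullary using (¬_; yes; no; contradiction)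
open import Relation.Binary.PropositionalEquality
  using (_≡_; refl; sym; trans; cong; cong₂; subst; subst₂; module ≡-Reasoning)

∈⇒≤foldr-⊔ : ∀ {x} {xs : List ℕ} → x ∈ xs → x ≤ foldr _⊔_ 0 xs
∈⇒≤foldr-⊔ {xs = y ∷ _} (here refl)   = m≤m⊔n y _
∈⇒≤foldr-⊔ {xs = y ∷ _} (there x∈ys) = ≤-trans (∈⇒≤foldr-⊔ x∈ys) (m≤n⊔m y _)

injective⇒≤length : ∀ {A : Set} {m} {xs : List A} (g : Fin m → A) →
  Injective _≡_ _≡_ g → (∀ i → g i ∈ xs) → m ≤ length xs
injective⇒≤length {xs = xs} g g-injective g∈xs = injective⇒≤ index-injective
  where
  open ≡-Reasoning
  index-injective : Injective _≡_ _≡_ (index ∘ g∈xs)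
  index-injective {i} {j} eq = g-injective (begin
    g i                        ≡⟨ lookup-index (g∈xs i) ⟩
    lookup xs (index (g∈xs i)) ≡⟨ cong (lookup xs) eq ⟩
    lookup xs (index (g∈xs j)) ≡⟨ lookup-index (g∈xs j) ⟨
    g j                        ∎)

∧-≡true⁻ : ∀ a {b} → (a ∧ b) ≡ true → a ≡ true × b ≡ true
∧-≡true⁻ true b≡true = refl , b≡true

sameCopy⇒≡ : ∀ {c} {s t : Fin c} → sameCopy s t ≡ true → s ≡ t
sameCopy⇒≡ {s = s} {t} _ with s ≟ t
sameCopy⇒≡ _  | yes s≡t = s≡t
sameCopy⇒≡ () | no _

sameCopy-refl : ∀ {c} (t : Fin c) → sameCopy t t ≡ true
sameCopy-refl t with t ≟ t
... | yes _   = refl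
... | no t≢t = contradiction refl t≢t

HasTTP⇒HasTP : ∀ {n} (G : Graph n) {k} → HasTTP G k → HasTP G k
HasTTP⇒HasTP _ (f , nonempty , ttp) = f , nonempty , λ i j i<j → proj₁ (ttp i j i<j)

bounded-by-positive : ∀ {P : ℕ → Set} {k} → (∀ {m} → P (suc m) → suc m ≤ k) → ∀ m → P m → m ≤ k
bounded-by-positive _     zero    _ = z≤n
bounded-by-positive bound (suc m) p = bound p

module _ {n} (G : Graph n) where

  degree≤maxDegree : ∀ v → degree G v ≤ maxDegree G
  degree≤maxDegree v = ∈⇒≤foldr-⊔ (∈-map⁺ (degree G) (∈-allFin v))

  injective-neighbours⇒≤degree : ∀ {m} v (g : Fin m → Fin n) → Injective _≡_ _≡_ g →
    (∀ i → adj G v (g i) ≡ true) → m ≤ degree G v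
  injective-neighbours⇒≤degree v g g-injective v~g = injective⇒≤length g g-injective
    (λ i → ∈-filter⁺ (λ u → T? (adj G v u)) (∈-allFin (g i)) (subst T (sym (v~g i)) _))

  HasTP⇒≤maxDegree : ∀ {m} → HasTP G (suc m) → m ≤ maxDegree G
  HasTP⇒≤maxDegree {m} (f , nonempty , dom) =
    ≤-trans (injective-neighbours⇒≤degree v g g-injective v~g) (degree≤maxDegree v)
    where
    open ≡-Reasoning
    v : Fin n
    v = proj₁ (nonempty (fromℕ m))
    neighbour : ∀ (i : Fin m) → ∃ λ u → f u ≡ inject₁ i × adj G u v ≡ true
    neighbour i = dom (inject₁ i) (fromℕ m)
      (subst₂ _<_ (sym (toℕ-inject₁ i)) (sym (toℕ-fromℕ m)) (toℕ<n i))
      v (proj₂ (nonempty (fromℕ m)))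
    g : Fin m → Fin n
    g = proj₁ ∘ neighbour
    g-injective : Injective _≡_ _≡_ g
    g-injective {i} {j} gi≡gj = inject₁-injective (begin
      inject₁ i ≡⟨ proj₁ (proj₂ (neighbour i)) ⟨
      f (g i)   ≡⟨ cong f gi≡gj ⟩
      f (g j)   ≡⟨ proj₁ (proj₂ (neighbour j)) ⟩
      inject₁ j ∎)
    v~g : ∀ i → adj G v (g i) ≡ true
    v~g i = trans (adj-sym G v (g i)) (proj₂ (proj₂ (neighbour i)))

  last-class⇒Nonempty-classes : ∀ {m} (f : Fin n → Fin (suc m)) → (∃ λ v → f v ≡ fromℕ m) →
    (∀ i j → toℕ i < toℕ j → Dominates G f i j) → Nonempty-classes f
  last-class⇒Nonempty-classes {m} f (v , fv≡last) dom i with i ≟ fromℕ m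
  ... | yes refl    = v , fv≡last
  ... | no i≢last = map₂ proj₁ (dom i (fromℕ m) (≤∧≢⇒< (≤fromℕ i) i≢last) v fv≡last)

clamp : ∀ {m} → Fin m → ℕ → Fin m
clamp a t = fromℕ< (m<n⇒m⊓o<n t (toℕ<n a))

toℕ-clamp : ∀ {m} (a : Fin m) t → toℕ (clamp a t) ≡ toℕ a ⊓ t
toℕ-clamp a t = toℕ-fromℕ< _

clamp-≤ : ∀ {m} {a : Fin m} {t} → toℕ a ≤ t → clamp a t ≡ a
clamp-≤ {a = a} {t} a≤t = toℕ-injective (trans (toℕ-clamp a t) (m≤n⇒m⊓n≡m a≤t))

module Copies (c : ℕ) {n} (G : Graph n) where

  copyOf-combine : ∀ (t : Fin c) (v : Fin n) → copyOf c (combine t v) ≡ t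
  copyOf-combine t v = cong proj₁ (remQuot-combine t v)

  vertexOf-combine : ∀ (t : Fin c) (v : Fin n) → vertexOf c (combine t v) ≡ v
  vertexOf-combine t v = cong proj₂ (remQuot-combine t v)

  combine-elim : ∀ {P : Fin (c * n) → Set} → (∀ t v → P (combine t v)) → ∀ x → P x
  combine-elim P-combine x with combine-surjective {c} {n} x
  ... | t , v , refl = P-combine t v

  adj-combine : ∀ (s t : Fin c) (u v : Fin n) →
    adj (copies c G) (combine s u) (combine t v) ≡ (sameCopy s t ∧ adj G u v)
  adj-combine s t u v = cong₂ _∧_
    (cong₂ sameCopy (copyOf-combine s u) (copyOf-combine t v))
    (cong₂ (adj G) (vertexOf-combine s u) (vertexOf-combine t v))

  adj-combine⁺ : ∀ t {u v} → adj G u v ≡ true → adj (copies c G) (combine t u) (combine t v) ≡ true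
  adj-combine⁺ t {u} {v} u~v =
    trans (adj-combine t t u v) (trans (cong (_∧ adj G u v) (sameCopy-refl t)) u~v)

  adj-combine⁻ : ∀ y t v → adj (copies c G) y (combine t v) ≡ true →
    ∃ λ u → y ≡ combine t u × adj G u v ≡ true
  adj-combine⁻ y t v = combine-elim {P = λ y → _ → ∃ λ u → y ≡ combine t u × _} neighbour y
    where
    neighbour : ∀ s u → adj (copies c G) (combine s u) (combine t v) ≡ true →
      ∃ λ u′ → combine s u ≡ combine t u′ × adj G u′ v ≡ true
    neighbour s u s,u~t,v with ∧-≡true⁻ (sameCopy s t) (trans (sym (adj-combine s t u v)) s,u~t,v)
    ... | s≡t , u~v = u , cong (λ s → combine s u) (sameCopy⇒≡ s≡t) , u~v

  HasTP-copies⇒HasTP : ∀ {m} → HasTP (copies c G) (suc m) → HasTP G (suc m)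
  HasTP-copies⇒HasTP {m} (F , nonempty , dom) =
    combine-elim {P = λ x → F x ≡ fromℕ m → HasTP G (suc m)} restrict-to-copy
      (proj₁ (nonempty (fromℕ m))) (proj₂ (nonempty (fromℕ m)))
    where
    restrict-to-copy : ∀ t v → F (combine t v) ≡ fromℕ m → HasTP G (suc m)
    restrict-to-copy t v Ftv≡last =
      F ∘ combine t , last-class⇒Nonempty-classes G (F ∘ combine t) (v , Ftv≡last) dom′ , dom′
      where
      dom′ : ∀ i j → toℕ i < toℕ j → Dominates G (F ∘ combine t) i j
      dom′ i j i<j w Ftw≡j with dom i j i<j (combine t w) Ftw≡j
      ... | y , Fy≡i , y~tw with adj-combine⁻ y t w y~tw
      ... | u , refl , u~w = u , Fy≡i , u~w

  module _ {k} (f : Fin n → Fin k) where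

    capped : Fin (c * n) → Fin k
    capped x = clamp (f (vertexOf c x)) (toℕ (copyOf c x))

    capped-combine : ∀ (t : Fin c) v → capped (combine t v) ≡ clamp (f v) (toℕ t)
    capped-combine t v =
      cong₂ (λ u s → clamp (f u) (toℕ s)) (vertexOf-combine t v) (copyOf-combine t v)

    capped-combine-bounds : ∀ (t : Fin c) v {j} → capped (combine t v) ≡ j →
      toℕ j ≤ toℕ (f v) × toℕ j ≤ toℕ t
    capped-combine-bounds t v refl = m≤n⊓o⇒m≤n _ _ capped≤fv⊓t , m≤n⊓o⇒m≤o _ _ capped≤fv⊓t
      where
      capped≤fv⊓t : toℕ (capped (combine t v)) ≤ toℕ (f v) ⊓ toℕ t
      capped≤fv⊓t = ≤-reflexive (trans (cong toℕ (capped-combine t v)) (toℕ-clamp (f v) (toℕ t)))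

    capped-combine-≤ : ∀ (t : Fin c) v {i} → f v ≡ i → toℕ i ≤ toℕ t → capped (combine t v) ≡ i
    capped-combine-≤ t v refl fv≤t = trans (capped-combine t v) (clamp-≤ fv≤t)

  HasTP⇒HasTTP-copies : ∀ {m} → suc m ≤ c → HasTP G (suc m) → HasTTP (copies c G) (suc m)
  HasTP⇒HasTTP-copies {m} m<c (f , nonempty , dom) =
    F , nonempty′ , λ i j i<j → dom′ i j i<j , ¬dom′ i j i<j
    where
    F : Fin (c * n) → Fin (suc m)
    F = capped f
    home : Fin (suc m) → Fin c
    home i = inject≤ i m<c
    F-home : ∀ i v → f v ≡ i → F (combine (home i) v) ≡ i
    F-home i v fv≡i = capped-combine-≤ f (home i) v fv≡i (≤-reflexive (sym (toℕ-inject≤ i m<c)))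
    nonempty′ : Nonempty-classes F
    nonempty′ i with nonempty i
    ... | v , fv≡i = combine (home i) v , F-home i v fv≡i
    dom′ : ∀ i j → toℕ i < toℕ j → Dominates (copies c G) F i j
    dom′ i j i<j = combine-elim {P = λ x → F x ≡ j → _} dominated
      where
      dominated : ∀ t v → F (combine t v) ≡ j →
        ∃ λ y → F y ≡ i × adj (copies c G) y (combine t v) ≡ true
      dominated t v Ftv≡j with capped-combine-bounds f t v Ftv≡j
      ... | j≤fv , j≤t with dom i (f v) (<-≤-trans i<j j≤fv) v refl
      ... | u , fu≡i , u~v =
        combine t u , capped-combine-≤ f t u fu≡i (<⇒≤ (<-≤-trans i<j j≤t)) , adj-combine⁺ t u~v
    ¬dom′ : ∀ i j → toℕ i < toℕ j → ¬ Dominates (copies c G) F j i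
    ¬dom′ i j i<j j-dom-i with nonempty i
    ... | v , fv≡i with j-dom-i (combine (home i) v) (F-home i v fv≡i)
    ... | y , Fy≡j , y~x with adj-combine⁻ y (home i) v y~x
    ... | u , refl , _ with capped-combine-bounds f (home i) u Fy≡j
    ... | _ , j≤home = <⇒≱ i<j (subst (toℕ j ≤_) (toℕ-inject≤ i m<c) j≤home)

lemma2 : ∀ {n} (G : Graph n) (k : ℕ) →
    Tr≡ G (suc k) ⇔ TTr≡ (copies (suc (maxDegree G)) G) (suc k)
lemma2 G k = mk⇔
    (λ (tp , max) → spread tp , bounded-by-positive (λ ttp → max _ (restrict ttp)))
    (λ (ttp , max) → restrict ttp , bounded-by-positive (λ tp → max _ (spread tp)))
  where
  c : ℕ
  c = suc (maxDegree G)
  open Copies c G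
  spread : ∀ {m} → HasTP G (suc m) → HasTTP (copies c G) (suc m)
  spread tp = HasTP⇒HasTTP-copies (s≤s (HasTP⇒≤maxDegree G tp)) tp
  restrict : ∀ {m} → HasTTP (copies c G) (suc m) → HasTP G (suc m)
  restrict ttp = HasTP-copies⇒HasTP (HasTTP⇒HasTP (copies c G) ttp)
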